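{- Let $L$ be a first-order language having at least two distinct closed terms $t_1,t_2$ and a formula $\alpha(v)$ with one free variable such that both $\alpha(t_1)\wedge\neg\alpha(t_2)$ and $\neg\alpha(t_1)\wedge\alpha(t_2)$ are satisfiable. Then for every choice function $f$ for $Fml(L)$ there is an $L$-structure $\mathcal M$ in which the existential generalization scheme $\varphi(t)\rightarrow\exists v\,\varphi(v)$ fails in $\langle\mathcal M,f\rangle$; namely, there are a formula $\varphi(v_1,v_2)$ of $L_s$ and closed terms $r_1,r_2$ such that $\langle\mathcal M,f\rangle\models^1_s\varphi(r_1,r_2)\wedge\neg\exists v_1\exists v_2\,\varphi(v_1,v_2)$.
   Context: $L$ is a first-order language with logical symbols $\wedge,\neg,\forall$ and equality; the other connectives and $\exists=\neg\forall\neg$ are abbreviations. $L_s=L\cup\{|\}$, where $|$ is a new binary connective; $Fml(L_s)$ is the set of all formulas built by the usual recursion together with the clause that $\varphi|\psi$ is a formula whenever $\varphi,\psi$ are. $Fml(L)$ is the set of formulas of $L$. A choice function for $Fml(L)$ is a map $f$ assigning to each unordered pair $\{\alpha,\beta\}$ of formulas of $L$ (singletons included) an element $f(\alpha,\beta)\in\{\alpha,\beta\}$; thus $f(\alpha,\beta)=f(\beta,\alpha)$ and $f(\alpha,\alpha)=\alpha$. Its collapsing map $\overline f:Fml(L_s)\to Fml(L)$ is defined recursively by $\overline f(\alpha)=\alpha$ for $\alpha\in Fml(L)$, $\overline f(\varphi\wedge\psi)=\overline f(\varphi)\wedge\overline f(\psi)$, $\overline f(\neg\varphi)=\neg\overline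 f(\varphi)$, $\overline f(\forall v\varphi)=\forall v\,\overline f(\varphi)$, $\overline f(\varphi|\psi)=f(\overline f(\varphi),\overline f(\psi))$. For an $L$-structure $\mathcal M$ and a sentence $\varphi$ of $L_s$, $\langle\mathcal M,f\rangle\models^1_s\varphi$ iff $\mathcal M\models\overline f(\varphi)$. -}

module Defs where

open import Data.Nat using (ℕ; _≟_)
open import Data.Bool using (Bool; true; false)
open import Data.Vec using (Vec; []; _∷_)
open import Data.Product using (Σ; _×_; _,_)
open import Data.Sum using (_⊎_)
open import Data.Empty using (⊥)
open import Relation.Nullary using (¬_; yes; no)
open import Relation.Binary.PropositionalEquality using (_≡_; _≢_)

-- A first-order signature: function symbols (constants = arity 0) and
-- relation symbols, each with an arity.  Equality is logical.
record Language : Set₁ where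
  field
    FunSym   : Set
    funArity : FunSym → ℕ
    RelSym   : Set
    relArity : RelSym → ℕ
open Language public

Var : Set
Var = ℕ

data Term (L : Language) : Set where
  var : Var → Term L
  fn  : (g : FunSym L) → Vec (Term L) (funArity L g) → Term L

-- Formulas.  Fm L false = Fml(L);  Fm L true = Fml(L_s) (with the connective |).
data Fm (L : Language) : Bool → Set where
  _≐_  : ∀ {b} → Term L → Term L → Fm L b
  rel  : ∀ {b} (R : RelSym L) → Vec (Term L) (relArity L R) → Fm L b
  _∧_  : ∀ {b} → Fm L b → Fm L b → Fm L b
  ¬'_  : ∀ {b} → Fm L b → Fm L b
  ∀'   : ∀ {b} → Var → Fm L b → Fm L b
  _∣_  : Fm L true → Fm L true → Fm L true

infixr 6 _∧_
infix 7 ¬'_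
infix 8 _≐_
infixr 6 _∣_

Fml : Language → Set
Fml L = Fm L false

Fmlₛ : Language → Set
Fmlₛ L = Fm L true

∃' : ∀ {L b} → Var → Fm L b → Fm L b
∃' v φ = ¬' (∀' v (¬' φ))

embed : ∀ {L} → Fml L → Fmlₛ L
embed (t ≐ u)   = t ≐ u
embed (rel R ts) = rel R ts
embed (φ ∧ ψ)   = embed φ ∧ embed ψ
embed (¬' φ)    = ¬' embed φ
embed (∀' v φ)  = ∀' v (embed φ)

mutual
  OccursT : ∀ {L} → Var → Term L → Set
  OccursT u (var w)   = u ≡ w
  OccursT u (fn g ts) = OccursTs u ts

  OccursTs : ∀ {L n} → Var → Vec (Term L) n → Set
  OccursTs u []       = ⊥
  OccursTs u (t ∷ ts) = OccursT u t ⊎ OccursTs u ts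

ClosedTerm : ∀ {L} → Term L → Set
ClosedTerm t = ∀ u → ¬ OccursT u t

FreeIn : ∀ {L b} → Var → Fm L b → Set
FreeIn u (t ≐ t')   = OccursT u t ⊎ OccursT u t'
FreeIn u (rel R ts) = OccursTs u ts
FreeIn u (φ ∧ ψ)    = FreeIn u φ ⊎ FreeIn u ψ
FreeIn u (¬' φ)     = FreeIn u φ
FreeIn u (∀' v φ)   = (u ≢ v) × FreeIn u φ
FreeIn u (φ ∣ ψ)    = FreeIn u φ ⊎ FreeIn u ψ

-- substitution of a term t for the free occurrences of variable v
-- (used only with closed t, so no capture can occur)
mutual
  substT : ∀ {L} → Var → Term L → Term L → Term L
  substT v t (var w) with v ≟ w
  ... | yes _ = t
  ... | no  _ = var w
  substT v t (fn g ts) = fn g (substTs v t ts)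

  substTs : ∀ {L n} → Var → Term L → Vec (Term L) n → Vec (Term L) n
  substTs v t []       = []
  substTs v t (s ∷ ss) = substT v t s ∷ substTs v t ss

subst : ∀ {L b} → Var → Term L → Fm L b → Fm L b
subst v t (s ≐ s')   = substT v t s ≐ substT v t s'
subst v t (rel R ss) = rel R (substTs v t ss)
subst v t (φ ∧ ψ)    = subst v t φ ∧ subst v t ψ
subst v t (¬' φ)     = ¬' subst v t φ
subst v t (∀' w φ) with v ≟ w
... | yes _ = ∀' w φ
... | no  _ = ∀' w (subst v t φ)
subst v t (φ ∣ ψ)    = subst v t φ ∣ subst v t ψ

record Structure (L : Language) : Set₁ where
  field
    Carrier : Set
    point   : Carrier
    funI    : (g : FunSym L) → Vec Carrier (funArity L g) → Carrier
    relI    : (R : RelSym L) → Vec Carrier (relArity L R) → Set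
open Structure public

Assignment : ∀ {L} → Structure L → Set
Assignment M = Var → Carrier M

update : ∀ {L} {M : Structure L} → Assignment M → Var → Carrier M → Assignment M
update ρ v d w with v ≟ w
... | yes _ = d
... | no  _ = ρ w

mutual
  eval : ∀ {L} (M : Structure L) → Assignment M → Term L → Carrier M
  eval M ρ (var w)   = ρ w
  eval M ρ (fn g ts) = funI M g (evals M ρ ts)

  evals : ∀ {L n} (M : Structure L) → Assignment M → Vec (Term L) n → Vec (Carrier M) n
  evals M ρ []       = []
  evals M ρ (t ∷ ts) = eval M ρ t ∷ evals M ρ ts

Sat : ∀ {L} (M : Structure L) → Assignment M → Fml L → Set
Sat M ρ (t ≐ u)    = eval M ρ t ≡ eval M ρ u
Sat M ρ (rel R ts) = relI M R (evals M ρ ts)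
Sat M ρ (φ ∧ ψ)    = Sat M ρ φ × Sat M ρ ψ
Sat M ρ (¬' φ)     = ¬ Sat M ρ φ
Sat M ρ (∀' v φ)   = (d : Carrier M) → Sat M (update {M = M} ρ v d) φ

_⊨_ : ∀ {L} → Structure L → Fml L → Set
M ⊨ φ = (ρ : Assignment M) → Sat M ρ φ

Satisfiable : ∀ {L} → Fml L → Set₁
Satisfiable {L} φ = Σ (Structure L) λ M → M ⊨ φ

-- choice functions for Fml(L): a choice on unordered pairs, presented as a
-- symmetric function on ordered pairs returning one of its arguments
record ChoiceFunction (L : Language) : Set where
  field
    choose  : Fml L → Fml L → Fml L
    sym     : ∀ α β → choose α β ≡ choose β α
    chooses : ∀ α β → (choose α β ≡ α) ⊎ (choose α β ≡ β)
open ChoiceFunction public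

collapse : ∀ {L} → ChoiceFunction L → Fmlₛ L → Fml L
collapse f (t ≐ u)    = t ≐ u
collapse f (rel R ts) = rel R ts
collapse f (φ ∧ ψ)    = collapse f φ ∧ collapse f ψ
collapse f (¬' φ)     = ¬' collapse f φ
collapse f (∀' v φ)   = ∀' v (collapse f φ)
collapse f (φ ∣ ψ)    = choose f (collapse f φ) (collapse f ψ)

_,_⊨¹ₛ_ : ∀ {L} → Structure L → ChoiceFunction L → Fmlₛ L → Set
M , f ⊨¹ₛ φ = M ⊨ collapse f φ

-- The separating formula is φ(v₁,v₂) := (β | γ) ∧ ¬ f(β,γ), where β = α(v₁) ∧ ¬α(v₂) and
-- γ = α(v₂) ∧ ¬α(v₁).  Whatever f does, φ collapses to f(β,γ) ∧ ¬ f(β,γ), so ∃v₁∃v₂φ is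
-- false in every structure.  An instance φ(r₁,r₂) with {r₁,r₂} = {t₁,t₂} collapses to
-- f(δ₁₂,δ₂₁) ∧ ¬ f(β,γ)(r₁,r₂), where δᵢⱼ = α(tᵢ) ∧ ¬α(tⱼ).  Take a model of the chosen
-- δ = f(δ₁₂,δ₂₁) and orient (r₁,r₂) so that f(β,γ)(r₁,r₂) is the other δ, which is false there.
module Submission where

open import Defs
open import Data.Product using (Σ; _×_; _,_)
open import Data.Sum using (_⊎_)
open import Relation.Binary.PropositionalEquality using (_≡_; _≢_)

open import Data.Nat using (ℕ; suc; _⊔_; _≤_; _≟_)
open import Data.Nat.Properties using (m⊔n≤o⇒m≤o; m⊔n≤o⇒n≤o; n≮n; ≤-refl; n≤1+n; 1+n≢n)
open import Data.Vec using (Vec; []; _∷_)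
open import Data.Sum using (inj₁; inj₂; [_,_]; [_,_]′)
import Data.Sum as Sum
import Data.Product as Product
open import Data.Empty using (⊥-elim)
open import Function using (_∘_; id)
open import Relation.Nullary using (¬_; yes; no)
open import Relation.Binary.PropositionalEquality using (refl; trans; cong; cong₂; module ≡-Reasoning)
import Relation.Binary.PropositionalEquality as ≡

mutual
  varBoundT : ∀ {L} → Term L → ℕ
  varBoundT (var u)   = suc u
  varBoundT (fn g ts) = varBoundTs ts

  varBoundTs : ∀ {L n} → Vec (Term L) n → ℕ
  varBoundTs []       = 0
  varBoundTs (t ∷ ts) = varBoundT t ⊔ varBoundTs ts

varBound : ∀ {L b} → Fm L b → ℕ
varBound (s ≐ t)    = varBoundT s ⊔ varBoundT t
varBound (rel R ts) = varBoundTs ts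
varBound (φ ∧ ψ)    = varBound φ ⊔ varBound ψ
varBound (¬' φ)     = varBound φ
varBound (∀' u φ)   = suc u ⊔ varBound φ
varBound (φ ∣ ψ)    = varBound φ ⊔ varBound ψ

⊔≤⇒ˡ : ∀ {m n o} → m ⊔ n ≤ o → m ≤ o
⊔≤⇒ˡ {m} {n} = m⊔n≤o⇒m≤o m n

⊔≤⇒ʳ : ∀ {m n o} → m ⊔ n ≤ o → n ≤ o
⊔≤⇒ʳ {m} {n} = m⊔n≤o⇒n≤o m n

mutual
  notOccurs-varBoundT : ∀ {L} {w} (s : Term L) → varBoundT s ≤ w → ¬ OccursT w s
  notOccurs-varBoundT (var u)   le refl = n≮n u le
  notOccurs-varBoundT (fn g ts) le      = notOccurs-varBoundTs ts le

  notOccurs-varBoundTs : ∀ {L n} {w} (ts : Vec (Term L) n) → varBoundTs ts ≤ w → ¬ OccursTs w ts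
  notOccurs-varBoundTs (t ∷ ts) le (inj₁ o) = notOccurs-varBoundT t (⊔≤⇒ˡ le) o
  notOccurs-varBoundTs (t ∷ ts) le (inj₂ o) = notOccurs-varBoundTs ts (⊔≤⇒ʳ le) o

notFree-varBound : ∀ {L b} {w} (φ : Fm L b) → varBound φ ≤ w → ¬ FreeIn w φ
notFree-varBound (s ≐ t)    le (inj₁ o)  = notOccurs-varBoundT s (⊔≤⇒ˡ le) o
notFree-varBound (s ≐ t)    le (inj₂ o)  = notOccurs-varBoundT t (⊔≤⇒ʳ le) o
notFree-varBound (rel R ts) le o         = notOccurs-varBoundTs ts le o
notFree-varBound (φ ∧ ψ)    le (inj₁ o)  = notFree-varBound φ (⊔≤⇒ˡ le) o
notFree-varBound (φ ∧ ψ)    le (inj₂ o)  = notFree-varBound ψ (⊔≤⇒ʳ le) o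
notFree-varBound (¬' φ)     le o         = notFree-varBound φ le o
notFree-varBound (∀' u φ)   le (_ , o)   = notFree-varBound φ (⊔≤⇒ʳ {suc u} {varBound φ} le) o
notFree-varBound (φ ∣ ψ)    le (inj₁ o)  = notFree-varBound φ (⊔≤⇒ˡ le) o
notFree-varBound (φ ∣ ψ)    le (inj₂ o)  = notFree-varBound ψ (⊔≤⇒ʳ le) o

mutual
  substT-notOccurs : ∀ {L} w (r s : Term L) → ¬ OccursT w s → substT w r s ≡ s
  substT-notOccurs w r (var u) w∉ with w ≟ u
  ... | yes w≡u = ⊥-elim (w∉ w≡u)
  ... | no _    = refl
  substT-notOccurs w r (fn g ts) w∉ = cong (fn g) (substTs-notOccurs w r ts w∉)

  substTs-notOccurs : ∀ {L n} w (r : Term L) (ts : Vec (Term L) n) → ¬ OccursTs w ts → substTs w r ts ≡ ts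
  substTs-notOccurs w r []       w∉ = refl
  substTs-notOccurs w r (t ∷ ts) w∉ =
    cong₂ _∷_ (substT-notOccurs w r t (w∉ ∘ inj₁)) (substTs-notOccurs w r ts (w∉ ∘ inj₂))

subst-notFree : ∀ {L b} w (r : Term L) (φ : Fm L b) → ¬ FreeIn w φ → subst w r φ ≡ φ
subst-notFree w r (s ≐ t)    w∉ = cong₂ _≐_ (substT-notOccurs w r s (w∉ ∘ inj₁)) (substT-notOccurs w r t (w∉ ∘ inj₂))
subst-notFree w r (rel R ts) w∉ = cong (rel R) (substTs-notOccurs w r ts w∉)
subst-notFree w r (φ ∧ ψ)    w∉ = cong₂ _∧_ (subst-notFree w r φ (w∉ ∘ inj₁)) (subst-notFree w r ψ (w∉ ∘ inj₂))
subst-notFree w r (¬' φ)     w∉ = cong ¬'_ (subst-notFree w r φ w∉)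
subst-notFree w r (∀' u φ)   w∉ with w ≟ u
... | yes _   = refl
... | no w≢u  = cong (∀' u) (subst-notFree w r φ (λ o → w∉ (w≢u , o)))
subst-notFree w r (φ ∣ ψ)    w∉ = cong₂ _∣_ (subst-notFree w r φ (w∉ ∘ inj₁)) (subst-notFree w r ψ (w∉ ∘ inj₂))

subst-fresh : ∀ {L b} w (r : Term L) (φ : Fm L b) → varBound φ ≤ w → subst w r φ ≡ φ
subst-fresh w r φ = subst-notFree w r φ ∘ notFree-varBound φ

mutual
  OccursT-subst : ∀ {L} {u} v (s t : Term L) → OccursT u (substT v s t) → OccursT u s ⊎ (u ≢ v × OccursT u t)
  OccursT-subst v s (var x) o with v ≟ x
  ... | yes _   = inj₁ o
  ... | no v≢x  = inj₂ ((λ u≡v → v≢x (trans (≡.sym u≡v) o)) , o)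
  OccursT-subst v s (fn g ts) o = OccursTs-subst v s ts o

  OccursTs-subst : ∀ {L n} {u} v (s : Term L) (ts : Vec (Term L) n)
    → OccursTs u (substTs v s ts) → OccursT u s ⊎ (u ≢ v × OccursTs u ts)
  OccursTs-subst v s (t ∷ ts) (inj₁ o) = Sum.map₂ (Product.map₂ inj₁) (OccursT-subst v s t o)
  OccursTs-subst v s (t ∷ ts) (inj₂ o) = Sum.map₂ (Product.map₂ inj₂) (OccursTs-subst v s ts o)

FreeIn-subst : ∀ {L b} {u} v (s : Term L) (φ : Fm L b) → FreeIn u (subst v s φ) → OccursT u s ⊎ (u ≢ v × FreeIn u φ)
FreeIn-subst v s (t ≐ t')   (inj₁ o) = Sum.map₂ (Product.map₂ inj₁) (OccursT-subst v s t o)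
FreeIn-subst v s (t ≐ t')   (inj₂ o) = Sum.map₂ (Product.map₂ inj₂) (OccursT-subst v s t' o)
FreeIn-subst v s (rel R ts) o        = OccursTs-subst v s ts o
FreeIn-subst v s (φ ∧ ψ)    (inj₁ o) = Sum.map₂ (Product.map₂ inj₁) (FreeIn-subst v s φ o)
FreeIn-subst v s (φ ∧ ψ)    (inj₂ o) = Sum.map₂ (Product.map₂ inj₂) (FreeIn-subst v s ψ o)
FreeIn-subst v s (¬' φ)     o        = FreeIn-subst v s φ o
FreeIn-subst v s (∀' x φ)   o with v ≟ x
FreeIn-subst v s (∀' x φ) (u≢x , o) | yes v≡x = inj₂ ((λ u≡v → u≢x (trans u≡v v≡x)) , (u≢x , o))
FreeIn-subst v s (∀' x φ) (u≢x , o) | no _    = Sum.map₂ (Product.map₂ (u≢x ,_)) (FreeIn-subst v s φ o)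
FreeIn-subst v s (φ ∣ ψ)    (inj₁ o) = Sum.map₂ (Product.map₂ inj₁) (FreeIn-subst v s φ o)
FreeIn-subst v s (φ ∣ ψ)    (inj₂ o) = Sum.map₂ (Product.map₂ inj₂) (FreeIn-subst v s ψ o)

notFree-subst : ∀ {L b} {w} v (s : Term L) (φ : Fm L b) → ¬ OccursT w s → ¬ FreeIn w φ → ¬ FreeIn w (subst v s φ)
notFree-subst v s φ w∉s w∉φ = [ w∉s , w∉φ ∘ Product.proj₂ ] ∘ FreeIn-subst v s φ

FreeIn-rename-sole : ∀ {L b} {u} v w (φ : Fm L b)
  → (∀ x → FreeIn x φ → x ≡ v) → FreeIn u (subst v (var w) φ) → u ≡ w
FreeIn-rename-sole v w φ onlyV = [ id , (λ { (u≢v , o) → ⊥-elim (u≢v (onlyV _ o)) }) ] ∘ FreeIn-subst v (var w) φ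

mutual
  substT-rename : ∀ {L} w v (r s : Term L) → varBoundT s ≤ w → substT w r (substT v (var w) s) ≡ substT v r s
  substT-rename {L} w v r (var u) le with v ≟ u
  ... | no _  = substT-notOccurs w r (var u) (notOccurs-varBoundT {L} {w} (var u) le)
  ... | yes _ with w ≟ w
  ...   | yes _   = refl
  ...   | no w≢w  = ⊥-elim (w≢w refl)
  substT-rename w v r (fn g ts) le = cong (fn g) (substTs-rename w v r ts le)

  substTs-rename : ∀ {L n} w v (r : Term L) (ts : Vec (Term L) n)
    → varBoundTs ts ≤ w → substTs w r (substTs v (var w) ts) ≡ substTs v r ts
  substTs-rename w v r []       le = refl
  substTs-rename w v r (t ∷ ts) le =
    cong₂ _∷_ (substT-rename w v r t (⊔≤⇒ˡ le)) (substTs-rename w v r ts (⊔≤⇒ʳ le))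

subst-rename : ∀ {L b} w v (r : Term L) (φ : Fm L b) → varBound φ ≤ w → subst w r (subst v (var w) φ) ≡ subst v r φ
subst-rename w v r (s ≐ t)    le = cong₂ _≐_ (substT-rename w v r s (⊔≤⇒ˡ le)) (substT-rename w v r t (⊔≤⇒ʳ le))
subst-rename w v r (rel R ts) le = cong (rel R) (substTs-rename w v r ts le)
subst-rename w v r (φ ∧ ψ)    le = cong₂ _∧_ (subst-rename w v r φ (⊔≤⇒ˡ le)) (subst-rename w v r ψ (⊔≤⇒ʳ le))
subst-rename w v r (¬' φ)     le = cong ¬'_ (subst-rename w v r φ le)
subst-rename w v r (∀' u φ)   le with v ≟ u
... | yes _ = subst-fresh w r (∀' u φ) le
... | no _ with w ≟ u
...   | yes refl = ⊥-elim (n≮n w (⊔≤⇒ˡ {suc w} {varBound φ} le))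
...   | no _     = cong (∀' u) (subst-rename w v r φ (⊔≤⇒ʳ {suc u} {varBound φ} le))
subst-rename w v r (φ ∣ ψ)    le = cong₂ _∣_ (subst-rename w v r φ (⊔≤⇒ˡ le)) (subst-rename w v r ψ (⊔≤⇒ʳ le))

subst-embed : ∀ {L} w (t : Term L) (φ : Fml L) → subst w t (embed φ) ≡ embed (subst w t φ)
subst-embed w t (s ≐ s')   = refl
subst-embed w t (rel R ts) = refl
subst-embed w t (φ ∧ ψ)    = cong₂ _∧_ (subst-embed w t φ) (subst-embed w t ψ)
subst-embed w t (¬' φ)     = cong ¬'_ (subst-embed w t φ)
subst-embed w t (∀' u φ) with w ≟ u
... | yes _ = refl
... | no _  = cong (∀' u) (subst-embed w t φ)

collapse-embed : ∀ {L} (f : ChoiceFunction L) (φ : Fml L) → collapse f (embed φ) ≡ φ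
collapse-embed f (s ≐ s')   = refl
collapse-embed f (rel R ts) = refl
collapse-embed f (φ ∧ ψ)    = cong₂ _∧_ (collapse-embed f φ) (collapse-embed f ψ)
collapse-embed f (¬' φ)     = cong ¬'_ (collapse-embed f φ)
collapse-embed f (∀' u φ)   = cong (∀' u) (collapse-embed f φ)

FreeIn-embed : ∀ {L} {u} (φ : Fml L) → FreeIn u (embed φ) → FreeIn u φ
FreeIn-embed (s ≐ s')   o        = o
FreeIn-embed (rel R ts) o        = o
FreeIn-embed (φ ∧ ψ)    (inj₁ o) = inj₁ (FreeIn-embed φ o)
FreeIn-embed (φ ∧ ψ)    (inj₂ o) = inj₂ (FreeIn-embed ψ o)
FreeIn-embed (¬' φ)     o        = FreeIn-embed φ o
FreeIn-embed (∀' x φ)   (u≢x , o) = u≢x , FreeIn-embed φ o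

collapse-subst-embed : ∀ {L} (f : ChoiceFunction L) w (t : Term L) (φ : Fml L)
  → collapse f (subst w t (embed φ)) ≡ subst w t φ
collapse-subst-embed f w t φ = trans (cong (collapse f) (subst-embed w t φ)) (collapse-embed f (subst w t φ))

∃-unsat : ∀ {L} (M : Structure L) w (φ : Fml L) → (∀ ρ → ¬ Sat M ρ φ) → ∀ ρ → ¬ Sat M ρ (∃' w φ)
∃-unsat M w φ unsat ρ ∃φ = ∃φ (λ d → unsat (update {M = M} ρ w d))

choiceClash : ∀ {L} → ChoiceFunction L → Fml L → Fml L → Fmlₛ L
choiceClash f β γ = (embed β ∣ embed γ) ∧ ¬' embed (choose f β γ)

choiceClash-unsat : ∀ {L} (f : ChoiceFunction L) (β γ : Fml L) (M : Structure L) ρ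
  → ¬ Sat M ρ (collapse f (choiceClash f β γ))
choiceClash-unsat f β γ M ρ (chosen , notChosen)
  rewrite collapse-embed f β | collapse-embed f γ | collapse-embed f (choose f β γ) = notChosen chosen

collapse-subst₂-choiceClash : ∀ {L} (f : ChoiceFunction L) w₁ w₂ (r₁ r₂ : Term L) (β γ : Fml L)
  → let inst = λ (ψ : Fml L) → subst w₂ r₂ (subst w₁ r₁ ψ)
    in collapse f (subst w₂ r₂ (subst w₁ r₁ (choiceClash f β γ))) ≡ choose f (inst β) (inst γ) ∧ ¬' inst (choose f β γ)
collapse-subst₂-choiceClash f w₁ w₂ r₁ r₂ β γ =
  cong₂ (λ δ ε → δ ∧ ¬' ε) (cong₂ (choose f) (collapse-subst₂-embed β) (collapse-subst₂-embed γ))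
                           (collapse-subst₂-embed (choose f β γ))
  where
  collapse-subst₂-embed : ∀ ψ → collapse f (subst w₂ r₂ (subst w₁ r₁ (embed ψ))) ≡ subst w₂ r₂ (subst w₁ r₁ ψ)
  collapse-subst₂-embed ψ =
    trans (cong (collapse f ∘ subst w₂ r₂) (subst-embed w₁ r₁ ψ)) (collapse-subst-embed f w₂ r₂ (subst w₁ r₁ ψ))

choiceClash-FreeIn : ∀ {L} {P : Var → Set} (f : ChoiceFunction L) (β γ : Fml L)
  → (∀ u → FreeIn u β → P u) → (∀ u → FreeIn u γ → P u) → ∀ u → FreeIn u (choiceClash f β γ) → P u
choiceClash-FreeIn f β γ Pβ Pγ u (inj₁ (inj₁ o)) = Pβ u (FreeIn-embed β o)
choiceClash-FreeIn f β γ Pβ Pγ u (inj₁ (inj₂ o)) = Pγ u (FreeIn-embed γ o)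
choiceClash-FreeIn f β γ Pβ Pγ u (inj₂ o) with choose f β γ | chooses f β γ
... | _ | inj₁ refl = Pβ u (FreeIn-embed β o)
... | _ | inj₂ refl = Pγ u (FreeIn-embed γ o)

ExistentialGeneralizationFails : ∀ {L} → ChoiceFunction L → Structure L → Set
ExistentialGeneralizationFails {L} f M =
  Σ (Fmlₛ L) λ φ → Σ Var λ v₁ → Σ Var λ v₂ → Σ (Term L) λ r₁ → Σ (Term L) λ r₂
  → (v₁ ≢ v₂) × (∀ u → FreeIn u φ → (u ≡ v₁) ⊎ (u ≡ v₂))
    × ClosedTerm r₁ × ClosedTerm r₂
    × (M , f ⊨¹ₛ (subst v₂ r₂ (subst v₁ r₁ φ) ∧ ¬' ∃' v₁ (∃' v₂ φ)))

module Separation {L} (α : Fml L) (v : Var) where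

  v₁ v₂ : Var
  v₁ = varBound α
  v₂ = suc v₁

  v₁≢v₂ : v₁ ≢ v₂
  v₁≢v₂ = 1+n≢n ∘ ≡.sym

  Sep : Term L → Term L → Fml L
  Sep a b = subst v a α ∧ ¬' subst v b α

  Sep-exclusive : ∀ {a b} (M : Structure L) ρ → Sat M ρ (Sep a b) → ¬ Sat M ρ (Sep b a)
  Sep-exclusive M ρ (αa , ¬αb) (αb , _) = ¬αb αb

  instantiate : Term L → Term L → Fml L → Fml L
  instantiate r₁ r₂ ψ = subst v₂ r₂ (subst v₁ r₁ ψ)

  instantiate-α₁ : ∀ {r₁} r₂ → ClosedTerm r₁ → instantiate r₁ r₂ (subst v (var v₁) α) ≡ subst v r₁ α
  instantiate-α₁ {r₁} r₂ closed = begin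
    subst v₂ r₂ (subst v₁ r₁ (subst v (var v₁) α))  ≡⟨ cong (subst v₂ r₂) (subst-rename v₁ v r₁ α ≤-refl) ⟩
    subst v₂ r₂ (subst v r₁ α)                      ≡⟨ subst-notFree v₂ r₂ (subst v r₁ α) v₂∉ ⟩
    subst v r₁ α                                    ∎
    where
    open ≡-Reasoning
    v₂∉ : ¬ FreeIn v₂ (subst v r₁ α)
    v₂∉ = notFree-subst v r₁ α (closed v₂) (notFree-varBound α (n≤1+n v₁))

  instantiate-α₂ : ∀ r₁ r₂ → instantiate r₁ r₂ (subst v (var v₂) α) ≡ subst v r₂ α
  instantiate-α₂ r₁ r₂ = begin
    subst v₂ r₂ (subst v₁ r₁ (subst v (var v₂) α))  ≡⟨ cong (subst v₂ r₂) (subst-notFree v₁ r₁ (subst v (var v₂) α) v₁∉) ⟩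
    subst v₂ r₂ (subst v (var v₂) α)                ≡⟨ subst-rename v₂ v r₂ α (n≤1+n v₁) ⟩
    subst v r₂ α                                    ∎
    where
    open ≡-Reasoning
    v₁∉ : ¬ FreeIn v₁ (subst v (var v₂) α)
    v₁∉ = notFree-subst v (var v₂) α v₁≢v₂ (notFree-varBound α ≤-refl)

  instantiate-Sep : ∀ {r₁} r₂ → ClosedTerm r₁ → instantiate r₁ r₂ (Sep (var v₁) (var v₂)) ≡ Sep r₁ r₂
  instantiate-Sep {r₁} r₂ closed = cong₂ (λ δ ε → δ ∧ ¬' ε) (instantiate-α₁ r₂ closed) (instantiate-α₂ r₁ r₂)

  instantiate-Sep-swapped : ∀ {r₁} r₂ → ClosedTerm r₁ → instantiate r₁ r₂ (Sep (var v₂) (var v₁)) ≡ Sep r₂ r₁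
  instantiate-Sep-swapped {r₁} r₂ closed = cong₂ (λ δ ε → δ ∧ ¬' ε) (instantiate-α₂ r₁ r₂) (instantiate-α₁ r₂ closed)

  FreeIn-Sep : (∀ u → FreeIn u α → u ≡ v) → ∀ x y u → FreeIn u (Sep (var x) (var y)) → (u ≡ x) ⊎ (u ≡ y)
  FreeIn-Sep onlyV x y u = Sum.map (FreeIn-rename-sole v x α onlyV) (FreeIn-rename-sole v y α onlyV)

module Counterexample {L} (f : ChoiceFunction L) (α : Fml L) (v : Var) (onlyV : ∀ u → FreeIn u α → u ≡ v) where
  open Separation α v public

  β γ : Fml L
  β = Sep (var v₁) (var v₂)
  γ = Sep (var v₂) (var v₁)

  φ : Fmlₛ L
  φ = choiceClash f β γ

  FreeIn-φ : ∀ u → FreeIn u φ → (u ≡ v₁) ⊎ (u ≡ v₂)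
  FreeIn-φ = choiceClash-FreeIn f β γ (FreeIn-Sep onlyV v₁ v₂) (λ u → Sum.swap ∘ FreeIn-Sep onlyV v₂ v₁ u)

  fails-at : ∀ {r₁ r₂} (M : Structure L) → ClosedTerm r₁ → ClosedTerm r₂
    → M ⊨ choose f (Sep r₁ r₂) (Sep r₂ r₁) → (∀ ρ → ¬ Sat M ρ (instantiate r₁ r₂ (choose f β γ)))
    → ExistentialGeneralizationFails f M
  fails-at {r₁} {r₂} M closed₁ closed₂ chosenHolds clashFails =
    φ , v₁ , v₂ , r₁ , r₂ , v₁≢v₂ , FreeIn-φ , closed₁ , closed₂ ,
    λ ρ → instanceHolds ρ , ∃-unsat M v₁ (∃' v₂ (collapse f φ)) (∃-unsat M v₂ (collapse f φ) (choiceClash-unsat f β γ M)) ρ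
    where
    collapse-instance : collapse f (subst v₂ r₂ (subst v₁ r₁ φ))
                      ≡ choose f (Sep r₁ r₂) (Sep r₂ r₁) ∧ ¬' instantiate r₁ r₂ (choose f β γ)
    collapse-instance =
      trans (collapse-subst₂-choiceClash f v₁ v₂ r₁ r₂ β γ)
            (cong (λ δ → δ ∧ ¬' instantiate r₁ r₂ (choose f β γ)) (cong₂ (choose f) (instantiate-Sep r₂ closed₁) (instantiate-Sep-swapped r₂ closed₁)))
    instanceHolds : ∀ ρ → Sat M ρ (collapse f (subst v₂ r₂ (subst v₁ r₁ φ)))
    instanceHolds ρ = ≡.subst (Sat M ρ) (≡.sym collapse-instance) (chosenHolds ρ , clashFails ρ)

  refuted : ∀ {a b δ} (M : Structure L) → M ⊨ Sep a b → δ ≡ Sep b a → ∀ ρ → ¬ Sat M ρ δ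
  refuted M holds refl ρ = Sep-exclusive M ρ (holds ρ)

  -- Orient the instance so that f(β,γ) becomes the unchosen separation Sep b a.
  fails : ∀ {a b} (M : Structure L) → ClosedTerm a → ClosedTerm b
    → choose f (Sep a b) (Sep b a) ≡ Sep a b → M ⊨ Sep a b → ExistentialGeneralizationFails f M
  fails {a} {b} M closed-a closed-b chosen holds with chooses f β γ
  ... | inj₁ c≡β = fails-at M closed-b closed-a
        (≡.subst (M ⊨_) (≡.sym (trans (sym f (Sep b a) (Sep a b)) chosen)) holds)
        (refuted M holds (trans (cong (instantiate b a) c≡β) (instantiate-Sep a closed-b)))
  ... | inj₂ c≡γ = fails-at M closed-a closed-b
        (≡.subst (M ⊨_) (≡.sym chosen) holds)
        (refuted M holds (trans (cong (instantiate a b) c≡γ) (instantiate-Sep-swapped b closed-a)))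

-- The hypotheses t₁ ≢ t₂ and FreeIn v α are implied by the two satisfiability assumptions.
corollary3p4 : (L : Language) (t₁ t₂ : Term L) (α : Fml L) (v : Var)
    → ClosedTerm t₁ → ClosedTerm t₂ → t₁ ≢ t₂
    → FreeIn v α → (∀ u → FreeIn u α → u ≡ v)
    → Satisfiable (subst v t₁ α ∧ ¬' subst v t₂ α)
    → Satisfiable (¬' subst v t₁ α ∧ subst v t₂ α)
    → (f : ChoiceFunction L)
    → Σ (Structure L) λ M → Σ (Fmlₛ L) λ φ → Σ Var λ v₁ → Σ Var λ v₂
      → Σ (Term L) λ r₁ → Σ (Term L) λ r₂
      → (v₁ ≢ v₂) × (∀ u → FreeIn u φ → (u ≡ v₁) ⊎ (u ≡ v₂))
        × ClosedTerm r₁ × ClosedTerm r₂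
        × (M , f ⊨¹ₛ (subst v₂ r₂ (subst v₁ r₁ φ) ∧ ¬' ∃' v₁ (∃' v₂ φ)))
corollary3p4 L t₁ t₂ α v closed₁ closed₂ _ _ onlyV (M₁₂ , sat₁₂) (M₂₁ , sat₂₁) f =
  [ (λ chosen → M₁₂ , fails M₁₂ closed₁ closed₂ chosen sat₁₂)
  , (λ chosen → M₂₁ , fails M₂₁ closed₂ closed₁ (trans (sym f (Sep t₂ t₁) (Sep t₁ t₂)) chosen) (Product.swap ∘ sat₂₁))
  ]′ (chooses f (Sep t₁ t₂) (Sep t₂ t₁))
  where open Counterexample f α v onlyV
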